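{- Let $d\le n$. Multiplying an $n\times d$ matrix by a $d\times n$ matrix over a semiring in the MPC model with $n$ processors, each with $O(n)$ words of memory, requires $\Theta\!\left(\frac{d}{\sqrt{n}}\right)$ communication rounds; that is, it can be done in $O(d/\sqrt{n})$ rounds and every algorithm needs $\Omega(d/\sqrt{n})$ rounds.
   Context: MPC model: there are $P$ processors, each with $M$ words of local memory; the input is distributed evenly among the processors and the output must be distributed evenly at the end; computation proceeds in synchronous rounds of local computation followed by message exchange, each processor sending and receiving $O(M)$ words per round. Over a general semiring, each product (term) $a_{ix}b_{xj}$ contributing to $c_{ij}=\sum_x a_{ix}b_{xj}$ must be computed explicitly by a processor holding both factors, and terms contributing to different entries of $C$ cannot be combined. -}

module Defs where

open import Data.Nat using (ℕ; zero; suc; _+_; _*_; _≤_)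
open import Data.Fin using (Fin)
open import Data.Fin.Subset using (Subset; ⁅_⁆; _∪_; _∩_; Empty; ⊤; ⊥)
open import Data.List using (List; length; map; concat; _++_)
open import Data.Nat.ListAction using (sum)
open import Relation.Binary.PropositionalEquality using (_≡_)
open import Data.Sum using (_⊎_)
import Data.List as List
open import Data.List.Membership.Propositional using (_∈_)
open import Data.Product using (Σ; ∃; _×_; _,_)

-- A memory word is a semiring value, which (over a general semiring) can
-- only be one of:
--   aW i x      : the input entry a_{ix}
--   bW x j      : the input entry b_{xj}
--   sW i j S    : the partial sum  Σ_{x ∈ S} a_{ix} b_{xj}  contributing to c_{ij}
-- (terms for different entries of C cannot be combined, and each term
--  a_{ix} b_{xj} must be formed explicitly from both factors).
data Word (n d : ℕ) : Set where
  aW : Fin n → Fin d → Word n d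
  bW : Fin d → Fin n → Word n d
  sW : Fin n → Fin n → Subset d → Word n d

data Derivable {n d : ℕ} (L : List (Word n d)) : Word n d → Set where
  held : ∀ {w} → w ∈ L → Derivable L w
  zero-sum : ∀ i j → Derivable L (sW i j ⊥)
  mul : ∀ {i x j} → Derivable L (aW i x) → Derivable L (bW x j) →
        Derivable L (sW i j ⁅ x ⁆)
  add : ∀ {i j S T} → Derivable L (sW i j S) → Derivable L (sW i j T) →
        Empty (S ∩ T) → Derivable L (sW i j (S ∪ T))

Config : ℕ → ℕ → Set
Config n d = Fin n → List (Word n d)

_⊆_ : ∀ {A : Set} → List A → List A → Set
xs ⊆ ys = ∀ {w} → w ∈ xs → w ∈ ys

Σp : ∀ {n} → (Fin n → ℕ) → ℕ
Σp {n} f = sum (List.tabulate {n = n} f)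

Step : ∀ {n d} → ℕ → Config n d → Config n d → Set
Step {n} {d} M C C' =
  Σ (Config n d) λ L →
  Σ (Fin n → Fin n → List (Word n d)) λ msg →
    (∀ p → length (L p) ≤ M)
  × (∀ p {w} → w ∈ L p → Derivable (C p) w)
  × (∀ p q → msg p q ⊆ L p)
  × (∀ p → Σp (λ q → length (msg p q)) ≤ M)
  × (∀ q → Σp (λ p → length (msg p q)) ≤ M)
  × (∀ q → C' q ⊆ (L q ++ concat (List.tabulate (λ p → msg p q))))
  × (∀ q → length (C' q) ≤ M)

data Run {n d : ℕ} (M : ℕ) : ℕ → Config n d → Config n d → Set where
  done : ∀ {C} → Run M 0 C C
  step : ∀ {R C C' C''} → Step M C C' → Run M R C' C'' → Run M (suc R) C C''

-- The input (all 2nd entries of A and B) is distributed evenly: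
-- every processor holds at most 2d = 2nd/n input words.
EvenInput : ∀ {n d} → Config n d → Set
EvenInput {n} {d} C =
    (∀ i x → ∃ λ p → aW i x ∈ C p)
  × (∀ x j → ∃ λ p → bW x j ∈ C p)
  × (∀ p {w} → w ∈ C p → (∃ λ i → ∃ λ x → w ≡ aW i x) ⊎ (∃ λ x → ∃ λ j → w ≡ bW x j))
  × (∀ p → length (C p) ≤ 2 * d)

-- The output: every entry c_{ij} = Σ_{x ∈ [d]} a_{ix} b_{xj} is held by
-- some processor (evenness of output is implied up to constants by the
-- O(n) memory bound, since there are n² output entries and n processors).
Output : ∀ {n d} → Config n d → Set
Output {n} {d} C = ∀ i j → ∃ λ p → sW i j ⊤ ∈ C p

-- Say processor p forms the term a_{ix} b_{xj} in a round if it then holds both factors and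
-- computes some partial sum of c_{ij}; since terms can neither be combined across entries nor created
-- otherwise, all n²d terms of the output are formed at some point. A processor holding B words that
-- computes M words forms at most √M · B terms: by Cauchy–Schwarz over the at most M pairs (i, j) it
-- computes sums for, the count is at most √(M · Σᵢⱼ αᵢ βⱼ), where αᵢ and βⱼ count the entries of row i
-- of A and of column j of B it holds, and Σᵢ αᵢ, Σⱼ βⱼ ≤ B. With M, B = O(n) this gives
-- n²d ≤ R · n · O(n^{3/2}) after R rounds, i.e. R = Ω(d/√n).
--
-- After one round in which processor q gathers row q of A and column q of B, an s × s grid
-- of processors (s ≈ √n), each owning an O(√n) × O(√n) block of C, streams the inner dimension in chunks
-- of s indices; each round moves O(n) words per processor, and ⌈d/s⌉ + 2 = O(1 + d/√n) rounds suffice.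

module Submission where

open import Defs
open import Data.Nat using (ℕ; zero; suc; _+_; _*_; _≤_; _<_; z≤n; s≤s; NonZero; >-nonZero; _/_; _%_; _≟_; _≤?_; _<?_)
open import Data.Nat.Properties
open import Data.Nat.DivMod
open import Data.Nat.Tactic.RingSolver using (solve-∀)
open import Data.Fin using (Fin; toℕ; fromℕ<) renaming (zero to fz; suc to fs)
import Data.Fin.Properties as Finₚ
open import Data.Fin.Subset using (Subset; ⁅_⁆; _∪_; _∩_; Empty; ⊤) renaming (_∈_ to _∈ₛ_; ⊥ to ∅)
open import Data.Fin.Subset.Properties
  using (∉⊥; ∈⊤; x∈⁅x⁆; x∈⁅y⁆⇒x≡y; x∈p∪q⁺; x∈p∪q⁻; x∈p∩q⁺; x∈p∩q⁻; ⊆-antisym; Empty-unique; nonempty?; ∩-distribˡ-∪; ∩-identityʳ)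
open import Data.Vec using (tabulate)
open import Data.Vec.Properties using (lookup∘tabulate; []=⇒lookup; lookup⇒[]=)
import Data.Vec.Properties as Vecₚ
import Data.Bool.Properties as Boolₚ
open import Data.List using (List; []; _∷_; [_]; length; _++_; concat; upTo)
import Data.List as List
open import Data.List.Properties using (length-++; length-upTo)
open import Data.List.Relation.Unary.All using (All; []; _∷_)
open import Data.List.Relation.Unary.Any using (Any; here; there; any?)
import Data.List.Relation.Unary.Any as Any
import Data.List.Relation.Unary.Any.Properties as Anyₚ
open import Data.List.Membership.Propositional using (_∈_)
open import Data.List.Membership.Propositional.Properties using (∈-++⁻; ∈-++⁺ˡ; ∈-++⁺ʳ; ∈-concat⁻; ∈-concat⁺′; ∈-upTo⁺)
open import Data.Product using (∃; _×_; _,_; proj₁; proj₂)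
open import Data.Sum using (_⊎_; inj₁; inj₂; [_,_]′)
import Data.Sum
open import Data.Empty using (⊥; ⊥-elim)
open import Relation.Nullary using (Dec; yes; no; ¬_)
open import Relation.Nullary.Decidable using (_×-dec_; does; dec-true)
import Relation.Unary as U
open import Relation.Binary.Definitions using (DecidableEquality)
open import Relation.Binary.PropositionalEquality hiding ([_])
open import Level using (Level)
open import Function using (_∘_; case_of_)

private variable
  ℓ₁ ℓ₂ ℓ₃ : Level
  P : Set ℓ₁
  Q : Set ℓ₂
  S : Set ℓ₃

𝟙 : Dec P → ℕ
𝟙 (yes _) = 1
𝟙 (no _) = 0

𝟙≤1 : (p : Dec P) → 𝟙 p ≤ 1
𝟙≤1 (yes _) = s≤s z≤n
𝟙≤1 (no _) = z≤n

𝟙-intro : (p : Dec P) → P → 1 ≤ 𝟙 p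
𝟙-intro (yes _) _ = s≤s z≤n
𝟙-intro (no ¬p) p = ⊥-elim (¬p p)

𝟙-mono : (p : Dec P) (q : Dec Q) → (P → Q) → 𝟙 p ≤ 𝟙 q
𝟙-mono (yes p) (yes _) f = s≤s z≤n
𝟙-mono (yes p) (no ¬q) f = ⊥-elim (¬q (f p))
𝟙-mono (no _) q f = z≤n

𝟙-absurd : (p : Dec P) → ¬ P → 𝟙 p ≤ 0
𝟙-absurd (yes p) ¬p = ⊥-elim (¬p p)
𝟙-absurd (no _) _ = z≤n

𝟙-× : (p : Dec P) (q : Dec Q) → 𝟙 (p ×-dec q) ≡ 𝟙 p * 𝟙 q
𝟙-× (yes _) (yes _) = refl
𝟙-× (yes _) (no _) = refl
𝟙-× (no _) (yes _) = refl
𝟙-× (no _) (no _) = refl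

𝟙-mono-× : (p : Dec P) (q : Dec Q) (r : Dec S) → (P → Q × S) → 𝟙 p ≤ 𝟙 q * 𝟙 r
𝟙-mono-× p q r f = ≤-trans (𝟙-mono p (q ×-dec r) f) (≤-reflexive (𝟙-× q r))

𝟙-mono-⊎ : (p : Dec P) (q : Dec Q) (r : Dec S) → (P → Q ⊎ S) → 𝟙 p ≤ 𝟙 q + 𝟙 r
𝟙-mono-⊎ (no _) q r f = z≤n
𝟙-mono-⊎ (yes p) (yes _) r f = s≤s z≤n
𝟙-mono-⊎ (yes p) (no ¬q) (yes _) f = s≤s z≤n
𝟙-mono-⊎ (yes p) (no ¬q) (no ¬r) f with f p
... | inj₁ q = ⊥-elim (¬q q)
... | inj₂ r = ⊥-elim (¬r r)

Σp-mono : ∀ {n} {f g : Fin n → ℕ} → (∀ i → f i ≤ g i) → Σp f ≤ Σp g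
Σp-mono {zero} h = z≤n
Σp-mono {suc n} h = +-mono-≤ (h fz) (Σp-mono {n} (h ∘ fs))

Σp-+ : ∀ {n} (f g : Fin n → ℕ) → Σp (λ i → f i + g i) ≡ Σp f + Σp g
Σp-+ {zero} f g = refl
Σp-+ {suc n} f g = trans (cong (f fz + g fz +_) (Σp-+ {n} (f ∘ fs) (g ∘ fs)))
  (+-interchange (f fz) (g fz) (Σp (f ∘ fs)) (Σp (g ∘ fs)))
  where
  +-interchange : ∀ a b c d → a + b + (c + d) ≡ a + c + (b + d)
  +-interchange = solve-∀

Σp-* : ∀ {n} (c : ℕ) (f : Fin n → ℕ) → Σp (λ i → c * f i) ≡ c * Σp f
Σp-* {zero} c f = sym (*-zeroʳ c)
Σp-* {suc n} c f = trans (cong (c * f fz +_) (Σp-* {n} c (f ∘ fs)))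
  (sym (*-distribˡ-+ c (f fz) (Σp (f ∘ fs))))

Σp-const : ∀ {n} c → Σp {n} (λ _ → c) ≡ n * c
Σp-const {zero} c = refl
Σp-const {suc n} c = cong (c +_) (Σp-const {n} c)

Σp-0 : ∀ {n} → Σp {n} (λ _ → 0) ≡ 0
Σp-0 {zero} = refl
Σp-0 {suc n} = Σp-0 {n}

Σp-count : ∀ n → Σp {n} (λ _ → 1) ≡ n
Σp-count n = trans (Σp-const {n} 1) (*-identityʳ n)

≤-Σp : ∀ {n} (f : Fin n → ℕ) i → f i ≤ Σp f
≤-Σp f fz = m≤m+n _ _
≤-Σp f (fs i) = ≤-trans (≤-Σp (f ∘ fs) i) (m≤n+m _ _)

Σp-swap : ∀ {n m} (g : Fin n → Fin m → ℕ) → Σp (λ a → Σp (λ b → g a b)) ≡ Σp (λ b → Σp (λ a → g a b))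
Σp-swap {zero} {m} g = sym (Σp-0 {m})
Σp-swap {suc n} {m} g =
  trans (cong (Σp (g fz) +_) (Σp-swap {n} {m} (g ∘ fs))) (sym (Σp-+ {m} (g fz) (λ b → Σp (λ a → g (fs a) b))))

Σp-𝟙≤1 : ∀ {m} {a} {P : Fin m → Set a} (p : ∀ i → Dec (P i)) → (∀ i i' → P i → P i' → i ≡ i') →
         Σp (λ i → 𝟙 (p i)) ≤ 1
Σp-𝟙≤1 {zero} p unique = z≤n
Σp-𝟙≤1 {suc m} p unique with p fz
... | yes p₀ = +-monoʳ-≤ 1 (≤-trans (Σp-mono {m} λ i → 𝟙-absurd (p (fs i)) (λ pᵢ → case unique fz (fs i) p₀ pᵢ of λ ()))
                                    (≤-reflexive (Σp-0 {m})))
... | no _ = Σp-𝟙≤1 {m} (p ∘ fs) (λ i i' pᵢ pᵢ' → Finₚ.suc-injective (unique (fs i) (fs i') pᵢ pᵢ'))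

record Summation (I : Set) : Set₁ where
  field
    ∑ : (I → ℕ) → ℕ
    ∑-mono : ∀ {f g : I → ℕ} → (∀ i → f i ≤ g i) → ∑ f ≤ ∑ g
    ∑-+ : ∀ (f g : I → ℕ) → ∑ (λ i → f i + g i) ≡ ∑ f + ∑ g
    ∑-* : ∀ (c : ℕ) (f : I → ℕ) → ∑ (λ i → c * f i) ≡ c * ∑ f

  ∑-cong : ∀ {f g : I → ℕ} → (∀ i → f i ≡ g i) → ∑ f ≡ ∑ g
  ∑-cong h = ≤-antisym (∑-mono (λ i → ≤-reflexive (h i))) (∑-mono (λ i → ≤-reflexive (sym (h i))))

  ∑-0 : ∑ (λ _ → 0) ≡ 0
  ∑-0 = ∑-* 0 (λ _ → 0)

  ∑-*ʳ : ∀ (c : ℕ) (f : I → ℕ) → ∑ (λ i → f i * c) ≡ ∑ f * c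
  ∑-*ʳ c f = trans (∑-cong (λ i → *-comm (f i) c)) (trans (∑-* c f) (*-comm c (∑ f)))

  ∑-≤0 : ∀ {f : I → ℕ} → (∀ i → f i ≤ 0) → ∑ f ≤ 0
  ∑-≤0 h = ≤-trans (∑-mono h) (≤-reflexive ∑-0)

open Summation public

finite : ∀ n → Summation (Fin n)
finite n = record { ∑ = Σp {n} ; ∑-mono = Σp-mono {n} ; ∑-+ = Σp-+ {n} ; ∑-* = Σp-* {n} }

_⊗_ : ∀ {I J} → Summation I → Summation J → Summation (I × J)
A ⊗ B = record
  { ∑ = λ f → ∑ A (λ i → ∑ B (λ j → f (i , j)))
  ; ∑-mono = λ h → ∑-mono A (λ i → ∑-mono B (λ j → h (i , j)))
  ; ∑-+ = λ f g → trans (∑-cong A (λ i → ∑-+ B (λ j → f (i , j)) (λ j → g (i , j)))) (∑-+ A _ _)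
  ; ∑-* = λ c f → trans (∑-cong A (λ i → ∑-* B c (λ j → f (i , j)))) (∑-* A c _)
  }

∑⊗-≤1 : ∀ {I J} (A : Summation I) (B : Summation J) (f : I → ℕ) (g : J → ℕ) →
        ∑ A f ≤ 1 → ∑ B g ≤ 1 → ∑ (A ⊗ B) (λ k → f (proj₁ k) * g (proj₂ k)) ≤ 1
∑⊗-≤1 A B f g f≤1 g≤1 = begin
    ∑ A (λ i → ∑ B (λ j → f i * g j)) ≡⟨ ∑-cong A (λ i → ∑-* B (f i) g) ⟩
    ∑ A (λ i → f i * ∑ B g)           ≡⟨ ∑-*ʳ A (∑ B g) f ⟩
    ∑ A f * ∑ B g                     ≤⟨ *-mono-≤ f≤1 g≤1 ⟩
    1                                 ∎
  where open ≤-Reasoning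

∑-𝟙-any≤length : ∀ {I W : Set} (A : Summation I) {Q : I → W → Set} (q : ∀ k w → Dec (Q k w)) →
                 (∀ w → ∑ A (λ k → 𝟙 (q k w)) ≤ 1) →
                 ∀ L → ∑ A (λ k → 𝟙 (any? (q k) L)) ≤ length L
∑-𝟙-any≤length A q unique [] = ∑-≤0 A (λ k → z≤n)
∑-𝟙-any≤length A {Q} q unique (w ∷ L) = begin
    ∑ A (λ k → 𝟙 (any? (q k) (w ∷ L)))
  ≤⟨ ∑-mono A (λ k → 𝟙-mono-⊎ (any? (q k) (w ∷ L)) (q k w) (any? (q k) L) head-or-tail) ⟩
    ∑ A (λ k → 𝟙 (q k w) + 𝟙 (any? (q k) L))
  ≡⟨ ∑-+ A _ _ ⟩
    ∑ A (λ k → 𝟙 (q k w)) + ∑ A (λ k → 𝟙 (any? (q k) L))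
  ≤⟨ +-mono-≤ (unique w) (∑-𝟙-any≤length A q unique L) ⟩
    suc (length L) ∎
  where
  open ≤-Reasoning
  head-or-tail : ∀ {k} → Any (Q k) (w ∷ L) → Q k w ⊎ Any (Q k) L
  head-or-tail (here h) = inj₁ h
  head-or-tail (there t) = inj₂ t

Σp-𝟙≤-injection : ∀ {m} {P : Fin m → Set} (p : ∀ i → Dec (P i)) (c : ℕ) (f : Fin m → ℕ) →
                  (∀ i → P i → f i < c) → (∀ i i' → P i → P i' → f i ≡ f i' → i ≡ i') →
                  Σp (λ i → 𝟙 (p i)) ≤ c
Σp-𝟙≤-injection {m} {P} p c f f<c f-injective = begin
    Σp (λ i → 𝟙 (p i))
  ≤⟨ Σp-mono {m} (λ i → 𝟙-mono (p i) (any? (hits i) (upTo c)) hit-in-range) ⟩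
    Σp (λ i → 𝟙 (any? (hits i) (upTo c)))
  ≤⟨ ∑-𝟙-any≤length (finite m) hits unique (upTo c) ⟩
    length (upTo c)
  ≡⟨ length-upTo c ⟩
    c ∎
  where
  open ≤-Reasoning
  Hits : Fin m → ℕ → Set
  Hits i v = P i × f i ≡ v
  hits : ∀ i v → Dec (Hits i v)
  hits i v = p i ×-dec (f i ≟ v)
  unique : ∀ v → Σp (λ i → 𝟙 (hits i v)) ≤ 1
  unique v = Σp-𝟙≤1 (λ i → hits i v)
    (λ i i' (pᵢ , eᵢ) (pᵢ' , eᵢ') → f-injective i i' pᵢ pᵢ' (trans eᵢ (sym eᵢ')))
  hit-in-range : ∀ {i} → P i → Any (Hits i) (upTo c)
  hit-in-range {i} pᵢ = Any.map (λ { refl → pᵢ , refl }) (∈-upTo⁺ (f<c i pᵢ))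

2ab≤a²+b² : ∀ a b → 2 * (a * b) ≤ a * a + b * b
2ab≤a²+b² a b = [ ordered , (λ b≤a → subst₂ _≤_ (cong (2 *_) (*-comm b a)) (+-comm (b * b) (a * a)) (ordered b≤a)) ]′
                  (≤-total a b)
  where
  expand : ∀ a t → 2 * (a * (a + t)) + t * t ≡ a * a + (a + t) * (a + t)
  expand = solve-∀
  ordered : ∀ {a b} → a ≤ b → 2 * (a * b) ≤ a * a + b * b
  ordered {a} a≤b with t , refl ← m≤n⇒∃[o]m+o≡n a≤b = ≤-trans (m≤m+n _ (t * t)) (≤-reflexive (expand a t))

module _ {I : Set} (A : Summation I) where

  ∑-square : ∀ (f : I → ℕ) → 2 * (∑ A f * ∑ A f) ≡ ∑ A (λ k → ∑ A (λ l → 2 * (f k * f l)))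
  ∑-square f = sym (begin
      ∑ A (λ k → ∑ A (λ l → 2 * (f k * f l)))
    ≡⟨ ∑-cong A (λ k → trans (∑-cong A (λ l → sym (*-assoc 2 (f k) (f l)))) (∑-* A (2 * f k) f)) ⟩
      ∑ A (λ k → 2 * f k * ∑ A f)
    ≡⟨ ∑-*ʳ A (∑ A f) (λ k → 2 * f k) ⟩
      ∑ A (λ k → 2 * f k) * ∑ A f
    ≡⟨ cong (_* ∑ A f) (∑-* A 2 f) ⟩
      2 * ∑ A f * ∑ A f
    ≡⟨ *-assoc 2 (∑ A f) (∑ A f) ⟩
      2 * (∑ A f * ∑ A f) ∎)
    where open ≡-Reasoning

  ∑-cauchy-schwarz-01 : ∀ (w m : I → ℕ) → (∀ k → w k ≤ 1) →
    ∑ A (λ k → w k * m k) * ∑ A (λ k → w k * m k) ≤ ∑ A w * ∑ A (λ k → w k * (m k * m k))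
  ∑-cauchy-schwarz-01 w m w≤1 = *-cancelˡ-≤ 2 (begin
      2 * (∑ A wm * ∑ A wm)
    ≡⟨ ∑-square wm ⟩
      ∑ A (λ k → ∑ A (λ l → 2 * (wm k * wm l)))
    ≤⟨ ∑-mono A (λ k → ∑-mono A (λ l → pointwise (w k) (w l) (m k) (m l) (w≤1 k) (w≤1 l))) ⟩
      ∑ A (λ k → ∑ A (λ l → w l * wm² k + w k * wm² l))
    ≡⟨ ∑-cong A (λ k → trans (∑-+ A _ _) (cong₂ _+_ (∑-*ʳ A (wm² k) w) (∑-* A (w k) wm²))) ⟩
      ∑ A (λ k → ∑ A w * wm² k + w k * ∑ A wm²)
    ≡⟨ ∑-+ A _ _ ⟩
      ∑ A (λ k → ∑ A w * wm² k) + ∑ A (λ k → w k * ∑ A wm²)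
    ≡⟨ cong₂ _+_ (∑-* A (∑ A w) wm²) (∑-*ʳ A (∑ A wm²) w) ⟩
      ∑ A w * ∑ A wm² + ∑ A w * ∑ A wm²
    ≡⟨ double (∑ A w * ∑ A wm²) ⟩
      2 * (∑ A w * ∑ A wm²) ∎)
    where
    open ≤-Reasoning
    wm wm² : I → ℕ
    wm k = w k * m k
    wm² k = w k * (m k * m k)
    double : ∀ x → x + x ≡ 2 * x
    double = solve-∀
    pointwise : ∀ u v a b → u ≤ 1 → v ≤ 1 →
                2 * ((u * a) * (v * b)) ≤ v * (u * (a * a)) + u * (v * (b * b))
    pointwise u v a b u≤1 v≤1 with n≤1⇒n≡0∨n≡1 u≤1 | n≤1⇒n≡0∨n≡1 v≤1
    ... | inj₁ refl | _ = z≤n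
    ... | inj₂ refl | inj₁ refl = ≤-reflexive (e a b)
      where e : ∀ a b → 2 * ((1 * a) * (0 * b)) ≡ 0 * (1 * (a * a)) + 1 * (0 * (b * b))
            e = solve-∀
    ... | inj₂ refl | inj₂ refl = subst₂ _≤_ (e₁ a b) (e₂ a b) (2ab≤a²+b² a b)
      where e₁ : ∀ a b → 2 * (a * b) ≡ 2 * ((1 * a) * (1 * b))
            e₁ = solve-∀
            e₂ : ∀ a b → a * a + b * b ≡ 1 * (1 * (a * a)) + 1 * (1 * (b * b))
            e₂ = solve-∀

m*m≤n*n⇒m≤n : ∀ m n → m * m ≤ n * n → m ≤ n
m*m≤n*n⇒m≤n m n m²≤n² with m ≤? n
... | yes m≤n = m≤n
... | no m≰n = ⊥-elim (<⇒≱ (*-mono-< (≰⇒> m≰n) (≰⇒> m≰n)) m²≤n²)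

square-bound-+ : ∀ a b p q X → a * a ≤ p * p * X → b * b ≤ q * q * X → (a + b) * (a + b) ≤ (p + q) * (p + q) * X
square-bound-+ a b p q X a² b² = begin
    (a + b) * (a + b)                         ≡⟨ e₁ a b ⟩
    a * a + 2 * (a * b) + b * b               ≤⟨ +-mono-≤ (+-mono-≤ a² (*-monoʳ-≤ 2 ab≤pqX)) b² ⟩
    p * p * X + 2 * (p * q * X) + q * q * X   ≡⟨ e₂ p q X ⟩
    (p + q) * (p + q) * X                     ∎
  where
  open ≤-Reasoning
  e₁ : ∀ a b → (a + b) * (a + b) ≡ a * a + 2 * (a * b) + b * b
  e₁ = solve-∀
  e₂ : ∀ p q X → p * p * X + 2 * (p * q * X) + q * q * X ≡ (p + q) * (p + q) * X
  e₂ = solve-∀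
  e₃ : ∀ a b → (a * b) * (a * b) ≡ (a * a) * (b * b)
  e₃ = solve-∀
  e₄ : ∀ p q X → (p * p * X) * (q * q * X) ≡ (p * q * X) * (p * q * X)
  e₄ = solve-∀
  ab≤pqX : a * b ≤ p * q * X
  ab≤pqX = m*m≤n*n⇒m≤n (a * b) (p * q * X) (subst₂ _≤_ (sym (e₃ a b)) (e₄ p q X) (*-mono-≤ a² b²))

Σp-square-bound : ∀ {n} (f : Fin n → ℕ) X → (∀ i → f i * f i ≤ X) → Σp f * Σp f ≤ n * n * X
Σp-square-bound {zero} f X h = z≤n
Σp-square-bound {suc n} f X h =
  square-bound-+ (f fz) (Σp (f ∘ fs)) 1 n X (≤-trans (h fz) (≤-reflexive (sym (+-identityʳ X))))
                 (Σp-square-bound (f ∘ fs) X (h ∘ fs))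

_≟W_ : ∀ {n d} → DecidableEquality (Word n d)
aW i x ≟W aW i' x' with i Finₚ.≟ i' | x Finₚ.≟ x'
... | yes refl | yes refl = yes refl
... | no i≢i' | _ = no (λ { refl → i≢i' refl })
... | yes _ | no x≢x' = no (λ { refl → x≢x' refl })
aW _ _ ≟W bW _ _ = no (λ ())
aW _ _ ≟W sW _ _ _ = no (λ ())
bW _ _ ≟W aW _ _ = no (λ ())
bW x j ≟W bW x' j' with x Finₚ.≟ x' | j Finₚ.≟ j'
... | yes refl | yes refl = yes refl
... | no x≢x' | _ = no (λ { refl → x≢x' refl })
... | yes _ | no j≢j' = no (λ { refl → j≢j' refl })
bW _ _ ≟W sW _ _ _ = no (λ ())
sW _ _ _ ≟W aW _ _ = no (λ ())
sW _ _ _ ≟W bW _ _ = no (λ ())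
sW i j T ≟W sW i' j' T' with i Finₚ.≟ i' | j Finₚ.≟ j' | Vecₚ.≡-dec Boolₚ._≟_ T T'
... | yes refl | yes refl | yes refl = yes refl
... | no i≢i' | _ | _ = no (λ { refl → i≢i' refl })
... | yes _ | no j≢j' | _ = no (λ { refl → j≢j' refl })
... | yes _ | yes _ | no T≢T' = no (λ { refl → T≢T' refl })

Σp-𝟙-≟≤1 : ∀ {n} (i₀ : Fin n) → Σp (λ i → 𝟙 (i Finₚ.≟ i₀)) ≤ 1
Σp-𝟙-≟≤1 i₀ = Σp-𝟙≤1 (λ i → i Finₚ.≟ i₀) (λ i i' e e' → trans e (sym e'))

∑⊗-𝟙-≟≤1 : ∀ {n m} (i₀ : Fin n) (j₀ : Fin m) →
           ∑ (finite n ⊗ finite m) (λ (i , j) → 𝟙 (i Finₚ.≟ i₀) * 𝟙 (j Finₚ.≟ j₀)) ≤ 1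
∑⊗-𝟙-≟≤1 {n} {m} i₀ j₀ = ∑⊗-≤1 (finite n) (finite m) _ _ (Σp-𝟙-≟≤1 i₀) (Σp-𝟙-≟≤1 j₀)

module _ {n d : ℕ} where

  open import Data.List.Membership.DecPropositional (_≟W_ {n} {d}) using (_∈?_)

  Memory : Set
  Memory = List (Word n d)

  SumFor : Fin n → Fin n → Word n d → Set
  SumFor i j (sW i' j' _) = i ≡ i' × j ≡ j'
  SumFor i j (aW _ _) = ⊥
  SumFor i j (bW _ _) = ⊥

  sumFor? : ∀ i j w → Dec (SumFor i j w)
  sumFor? i j (sW i' j' _) = (i Finₚ.≟ i') ×-dec (j Finₚ.≟ j')
  sumFor? i j (aW _ _) = no (λ ())
  sumFor? i j (bW _ _) = no (λ ())

  holdsA : Memory → Fin n → Fin d → ℕ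
  holdsA C i x = 𝟙 (aW i x ∈? C)

  holdsB : Memory → Fin d → Fin n → ℕ
  holdsB C x j = 𝟙 (bW x j ∈? C)

  computesSum : Memory → Fin n → Fin n → ℕ
  computesSum L i j = 𝟙 (any? (sumFor? i j) L)

  formable : Memory → Memory → Fin n → Fin d → Fin n → ℕ
  formable C L i x j = computesSum L i j * (holdsA C i x * holdsB C x j)

  formableTerms : Memory → Memory → ℕ
  formableTerms C L = Σp λ i → Σp λ j → Σp λ x → formable C L i x j

  sharedIndices : Memory → Fin n → Fin n → ℕ
  sharedIndices C i j = Σp λ x → holdsA C i x * holdsB C x j

  rowLoad : Memory → Fin n → ℕ
  rowLoad C i = Σp λ x → holdsA C i x

  colLoad : Memory → Fin n → ℕ
  colLoad C j = Σp λ x → holdsB C x j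

  Pairs : Summation (Fin n × Fin n)
  Pairs = finite n ⊗ finite n

  Entries : Summation (Fin n × Fin d)
  Entries = finite n ⊗ finite d

  ∑-computesSum≤length : ∀ L → ∑ Pairs (λ (i , j) → computesSum L i j) ≤ length L
  ∑-computesSum≤length = ∑-𝟙-any≤length Pairs (λ (i , j) → sumFor? i j) unique
    where
    unique : ∀ w → ∑ Pairs (λ (i , j) → 𝟙 (sumFor? i j w)) ≤ 1
    unique (sW i₀ j₀ T) = ≤-trans
      (∑-mono Pairs (λ (i , j) → 𝟙-mono-× (sumFor? i j (sW i₀ j₀ T)) (i Finₚ.≟ i₀) (j Finₚ.≟ j₀) (λ p → p)))
      (∑⊗-𝟙-≟≤1 i₀ j₀)
    unique (aW _ _) = ≤-trans (∑-≤0 Pairs (λ _ → z≤n)) z≤n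
    unique (bW _ _) = ≤-trans (∑-≤0 Pairs (λ _ → z≤n)) z≤n

  ∑-holdsA≤length : ∀ C → ∑ Entries (λ (i , x) → holdsA C i x) ≤ length C
  ∑-holdsA≤length = ∑-𝟙-any≤length Entries (λ (i , x) → aW i x ≟W_) unique
    where
    unique : ∀ w → ∑ Entries (λ (i , x) → 𝟙 (aW i x ≟W w)) ≤ 1
    unique (aW i₀ x₀) = ≤-trans
      (∑-mono Entries (λ (i , x) → 𝟙-mono-× (aW i x ≟W aW i₀ x₀) (i Finₚ.≟ i₀) (x Finₚ.≟ x₀) λ { refl → refl , refl }))
      (∑⊗-𝟙-≟≤1 i₀ x₀)
    unique (bW x j) = ≤-trans (∑-≤0 Entries (λ (i' , x') → 𝟙-absurd (aW i' x' ≟W bW x j) (λ ()))) z≤n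
    unique (sW i j T) = ≤-trans (∑-≤0 Entries (λ (i' , x') → 𝟙-absurd (aW i' x' ≟W sW i j T) (λ ()))) z≤n

  ∑-holdsB≤length : ∀ C → ∑ Entries (λ (j , x) → holdsB C x j) ≤ length C
  ∑-holdsB≤length = ∑-𝟙-any≤length Entries (λ (j , x) → bW x j ≟W_) unique
    where
    unique : ∀ w → ∑ Entries (λ (j , x) → 𝟙 (bW x j ≟W w)) ≤ 1
    unique (bW x₀ j₀) = ≤-trans
      (∑-mono Entries (λ (j , x) → 𝟙-mono-× (bW x j ≟W bW x₀ j₀) (j Finₚ.≟ j₀) (x Finₚ.≟ x₀) λ { refl → refl , refl }))
      (∑⊗-𝟙-≟≤1 j₀ x₀)
    unique (aW i x) = ≤-trans (∑-≤0 Entries (λ (j' , x') → 𝟙-absurd (bW x' j' ≟W aW i x) (λ ()))) z≤n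
    unique (sW i j T) = ≤-trans (∑-≤0 Entries (λ (j' , x') → 𝟙-absurd (bW x' j' ≟W sW i j T) (λ ()))) z≤n

  sharedIndices≤rowLoad : ∀ C i j → sharedIndices C i j ≤ rowLoad C i
  sharedIndices≤rowLoad C i j = Σp-mono {d} λ x →
    ≤-trans (*-monoʳ-≤ (holdsA C i x) (𝟙≤1 (bW x j ∈? C))) (≤-reflexive (*-identityʳ _))

  sharedIndices≤colLoad : ∀ C i j → sharedIndices C i j ≤ colLoad C j
  sharedIndices≤colLoad C i j = Σp-mono {d} λ x →
    ≤-trans (*-monoˡ-≤ (holdsB C x j) (𝟙≤1 (aW i x ∈? C))) (≤-reflexive (*-identityˡ _))

  formableTerms²≤ : ∀ C L → formableTerms C L * formableTerms C L ≤ length L * (length C * length C)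
  formableTerms²≤ C L = begin
      formableTerms C L * formableTerms C L
    ≡⟨ cong₂ _*_ as-∑ as-∑ ⟩
      ∑ Pairs (λ k → w k * m k) * ∑ Pairs (λ k → w k * m k)
    ≤⟨ ∑-cauchy-schwarz-01 Pairs w m (λ (i , j) → 𝟙≤1 (any? (sumFor? i j) L)) ⟩
      ∑ Pairs w * ∑ Pairs (λ k → w k * (m k * m k))
    ≤⟨ *-mono-≤ (∑-computesSum≤length L) (∑-mono Pairs w·m²≤loads) ⟩
      length L * ∑ Pairs (λ (i , j) → rowLoad C i * colLoad C j)
    ≡⟨ cong (length L *_) (trans (∑-cong (finite n) (λ i → Σp-* {n} (rowLoad C i) (colLoad C)))
                                 (∑-*ʳ (finite n) _ (rowLoad C))) ⟩
      length L * (Σp (rowLoad C) * Σp (colLoad C))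
    ≤⟨ *-monoʳ-≤ (length L) (*-mono-≤ (∑-holdsA≤length C) (∑-holdsB≤length C)) ⟩
      length L * (length C * length C) ∎
    where
    open ≤-Reasoning
    w m : Fin n × Fin n → ℕ
    w (i , j) = computesSum L i j
    m (i , j) = sharedIndices C i j
    as-∑ : formableTerms C L ≡ ∑ Pairs (λ k → w k * m k)
    as-∑ = ∑-cong (finite n) (λ i → ∑-cong (finite n) (λ j → Σp-* {d} (computesSum L i j) _))
    w·m²≤loads : ∀ k → w k * (m k * m k) ≤ rowLoad C (proj₁ k) * colLoad C (proj₂ k)
    w·m²≤loads (i , j) = begin
      w (i , j) * (m (i , j) * m (i , j)) ≤⟨ *-monoˡ-≤ _ (𝟙≤1 (any? (sumFor? i j) L)) ⟩
      1 * (m (i , j) * m (i , j))         ≡⟨ *-identityˡ _ ⟩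
      m (i , j) * m (i , j)               ≤⟨ *-mono-≤ (sharedIndices≤rowLoad C i j) (sharedIndices≤colLoad C i j) ⟩
      rowLoad C i * colLoad C j           ∎
  -- Each round is recorded as the memory before it together with the words computed locally in it.
  History : Set
  History = List (Config n d × Config n d)

  termsFormed : History → Fin n → Fin d → Fin n → ℕ
  termsFormed [] i x j = 0
  termsFormed ((C , L) ∷ h) i x j = Σp (λ p → formable (C p) (L p) i x j) + termsFormed h i x j

  Accounted : History → Memory → Set
  Accounted h Lm = ∀ {i j T x} → sW i j T ∈ Lm → x ∈ₛ T → 1 ≤ termsFormed h i x j

  derivable-sum-accounted : ∀ {h} {Lm : Memory} {i j T x} → Accounted h Lm → Derivable Lm (sW i j T) → x ∈ₛ T →
                            1 ≤ termsFormed h i x j ⊎ (aW i x ∈ Lm × bW x j ∈ Lm)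
  derivable-sum-accounted {h} acc (held m) x∈T = inj₁ (acc m x∈T)
  derivable-sum-accounted {h} acc (zero-sum i j) x∈T = ⊥-elim (∉⊥ x∈T)
  derivable-sum-accounted {h} acc (mul {x = y} (held a∈) (held b∈)) x∈T with x∈⁅y⁆⇒x≡y y x∈T
  ... | refl = inj₂ (a∈ , b∈)
  derivable-sum-accounted {h} acc (add {S = S} {T = T} dS dT _) x∈S∪T with x∈p∪q⁻ S T x∈S∪T
  ... | inj₁ x∈S = derivable-sum-accounted {h} acc dS x∈S
  ... | inj₂ x∈T = derivable-sum-accounted {h} acc dT x∈T

  step-accounted : ∀ {M h} {C C' : Config n d} (st : Step M C C') →
                   (∀ q → Accounted h (C q)) → ∀ q → Accounted ((C , proj₁ st) ∷ h) (C' q)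
  step-accounted {h = h} {C = C} (L , msg , _ , derivable , msg⊆L , _ , _ , C'⊆ , _) acc q {i} {j} {T} {x} m x∈T =
    accounted (computed-somewhere (C'⊆ q m))
    where
    computed-somewhere : ∀ {w} → w ∈ (L q ++ concat (List.tabulate (λ p → msg p q))) → ∃ λ p → w ∈ L p
    computed-somewhere m' with ∈-++⁻ (L q) m'
    ... | inj₁ kept = q , kept
    ... | inj₂ received with Anyₚ.tabulate⁻ (∈-concat⁻ (List.tabulate (λ p → msg p q)) received)
    ...   | p , sent = p , msg⊆L p q sent
    accounted : (∃ λ p → sW i j T ∈ L p) → 1 ≤ Σp (λ p → formable (C p) (L p) i x j) + termsFormed h i x j
    accounted (p , computed) with derivable-sum-accounted {h} (acc p) (derivable p computed) x∈T
    ... | inj₁ earlier = ≤-trans earlier (m≤n+m _ _)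
    ... | inj₂ (a∈ , b∈) = ≤-trans (≤-trans now (≤-Σp (λ p → formable (C p) (L p) i x j) p)) (m≤m+n _ _)
      where
      now : 1 ≤ formable (C p) (L p) i x j
      now = *-mono-≤ (𝟙-intro (any? (sumFor? i j) (L p)) (Any.map (λ { refl → refl , refl }) computed))
                     (*-mono-≤ (𝟙-intro (aW i x ∈? C p) a∈) (𝟙-intro (bW x j ∈? C p) b∈))

  history : ∀ {M R} {C C' : Config n d} → History → Run M R C C' → History
  history h done = h
  history {C = C} h (step st r) = history ((C , proj₁ st) ∷ h) r

  run-accounted : ∀ {M R} {C C' : Config n d} h → (∀ q → Accounted h (C q)) →
                  (r : Run M R C C') → ∀ q → Accounted (history h r) (C' q)
  run-accounted h acc done = acc
  run-accounted {C = C} h acc (step st r) = run-accounted ((C , proj₁ st) ∷ h) (step-accounted {h = h} st acc) r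

  LocallyBounded : ℕ → Config n d × Config n d → Set
  LocallyBounded X (C , L) = ∀ p → formableTerms (C p) (L p) * formableTerms (C p) (L p) ≤ X

  run-locally-bounded : ∀ {M R B} {C C' : Config n d} h → M ≤ B → (∀ p → length (C p) ≤ B) →
    All (LocallyBounded (M * (B * B))) h → (r : Run M R C C') →
    All (LocallyBounded (M * (B * B))) (history h r) × length (history h r) ≡ R + length h
  run-locally-bounded h M≤B C≤B bounded done = bounded , refl
  run-locally-bounded {M} {suc R} {B} {C} h M≤B C≤B bounded (step (L , _ , L≤M , _ , _ , _ , _ , _ , C'≤M) r) =
    let (bounded' , len) = run-locally-bounded ((C , L) ∷ h) M≤B (λ p → ≤-trans (C'≤M p) M≤B) (now ∷ bounded) r
    in bounded' , trans len (+-suc R (length h))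
    where
    now : LocallyBounded (M * (B * B)) (C , L)
    now p = ≤-trans (formableTerms²≤ (C p) (L p)) (*-mono-≤ (L≤M p) (*-mono-≤ (C≤B p) (C≤B p)))

  totalFormable : History → ℕ
  totalFormable [] = 0
  totalFormable ((C , L) ∷ h) = Σp (λ p → formableTerms (C p) (L p)) + totalFormable h

  Terms : Summation (Fin n × (Fin n × Fin d))
  Terms = finite n ⊗ (finite n ⊗ finite d)

  ∑-termsFormed : ∀ h → ∑ Terms (λ (i , j , x) → termsFormed h i x j) ≡ totalFormable h
  ∑-termsFormed [] = ∑-0 Terms
  ∑-termsFormed ((C , L) ∷ h) = trans (∑-+ Terms _ _) (cong₂ _+_ swap (∑-termsFormed h))
    where
    f : Fin n → Fin n → Fin d → Fin n → ℕ
    f i j x p = formable (C p) (L p) i x j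
    swap : (Σp λ i → Σp λ j → Σp λ x → Σp λ p → f i j x p) ≡ Σp (λ p → formableTerms (C p) (L p))
    swap = trans (∑-cong (finite n) λ i →
                   trans (∑-cong (finite n) λ j → Σp-swap {d} {n} (f i j))
                         (Σp-swap {n} {n} (λ j p → Σp (λ x → f i j x p))))
                 (Σp-swap {n} {n} (λ i p → Σp λ j → Σp λ x → f i j x p))

  totalFormable²≤ : ∀ X h → All (LocallyBounded X) h →
                    totalFormable h * totalFormable h ≤ (length h * n) * (length h * n) * X
  totalFormable²≤ X [] [] = z≤n
  totalFormable²≤ X ((C , L) ∷ h) (bounded ∷ bounded-h) =
    square-bound-+ (Σp (λ p → formableTerms (C p) (L p))) (totalFormable h) n (length h * n) X
      (Σp-square-bound (λ p → formableTerms (C p) (L p)) X bounded) (totalFormable²≤ X h bounded-h)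

  input-accounted : ∀ {C₀ : Config n d} → EvenInput C₀ → ∀ q → Accounted [] (C₀ q)
  input-accounted (_ , _ , inputs-only , _) q m _ with inputs-only q m
  ... | inj₁ (_ , _ , ())
  ... | inj₂ (_ , _ , ())

  every-term-formed : ∀ {M R} {C₀ C : Config n d} → EvenInput C₀ → (r : Run M R C₀ C) → Output C →
                      n * (n * d) ≤ totalFormable (history [] r)
  every-term-formed {C₀ = C₀} {C} even r out = begin
      n * (n * d)
    ≡⟨ sym (trans (∑-cong (finite n) λ i → trans (∑-cong (finite n) λ j → Σp-count d) (Σp-const {n} d))
                  (Σp-const {n} (n * d))) ⟩
      ∑ Terms (λ _ → 1)
    ≤⟨ ∑-mono Terms formed ⟩
      ∑ Terms (λ (i , j , x) → termsFormed (history [] r) i x j)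
    ≡⟨ ∑-termsFormed (history [] r) ⟩
      totalFormable (history [] r) ∎
    where
    open ≤-Reasoning
    formed : ∀ ((i , j , x) : Fin n × (Fin n × Fin d)) → 1 ≤ termsFormed (history [] r) i x j
    formed (i , j , x) with p , c∈ ← out i j = run-accounted [] (input-accounted even) r p c∈ ∈⊤

  totalFormable²≤rounds : ∀ {M R B} {C₀ C : Config n d} → M ≤ B → (∀ p → length (C₀ p) ≤ B) → (r : Run M R C₀ C) →
                          totalFormable (history [] r) * totalFormable (history [] r) ≤ (R * n) * (R * n) * (M * (B * B))
  totalFormable²≤rounds {M} {R} {B} M≤B C₀≤B r with run-locally-bounded [] M≤B C₀≤B [] r
  ... | bounded , len = subst (λ k → totalFormable (history [] r) * totalFormable (history [] r) ≤ (k * n) * (k * n) * (M * (B * B)))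
                              (trans len (+-identityʳ R)) (totalFormable²≤ (M * (B * B)) (history [] r) bounded)

rounds-lower-bound : ∀ K n d → d ≤ n → (C₀ : Config n d) → EvenInput C₀ → ∀ R C → Run (K * n) R C₀ C → Output C →
                     d * d ≤ K * (K + 2) * (K + 2) * (R * R * n)
rounds-lower-bound K zero .zero z≤n C₀ even R C r out = z≤n
rounds-lower-bound K n@(suc _) d d≤n C₀ even@(_ , _ , _ , C₀≤2d) R C r out = *-cancelˡ-≤ (n * n * n * n) (begin
    n * n * n * n * (d * d)
  ≡⟨ e₁ n d ⟩
    (n * (n * d)) * (n * (n * d))
  ≤⟨ *-mono-≤ (every-term-formed even r out) (every-term-formed even r out) ⟩
    totalFormable (history [] r) * totalFormable (history [] r)
  ≤⟨ totalFormable²≤rounds (m≤m+n _ _) (λ p → ≤-trans (C₀≤2d p) (m≤n+m (2 * d) (K * n))) r ⟩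
    (R * n) * (R * n) * (K * n * (B * B))
  ≤⟨ *-monoʳ-≤ ((R * n) * (R * n)) (*-monoʳ-≤ (K * n) (*-mono-≤ B≤ B≤)) ⟩
    (R * n) * (R * n) * (K * n * (((K + 2) * n) * ((K + 2) * n)))
  ≡⟨ e₂ R n K ⟩
    n * n * n * n * (K * (K + 2) * (K + 2) * (R * R * n)) ∎)
  where
  open ≤-Reasoning
  B = K * n + 2 * d
  e₃ : ∀ K n → K * n + 2 * n ≡ (K + 2) * n
  e₃ = solve-∀
  B≤ : B ≤ (K + 2) * n
  B≤ = ≤-trans (+-monoʳ-≤ (K * n) (*-monoʳ-≤ 2 d≤n)) (≤-reflexive (e₃ K n))
  e₁ : ∀ n d → n * n * n * n * (d * d) ≡ (n * (n * d)) * (n * (n * d))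
  e₁ = solve-∀
  e₂ : ∀ R n K → (R * n) * (R * n) * (K * n * (((K + 2) * n) * ((K + 2) * n))) ≡
                 n * n * n * n * (K * (K + 2) * (K + 2) * (R * R * n))
  e₂ = solve-∀

module _ {d : ℕ} where

  ⟦_⟧ : {P : Fin d → Set} → U.Decidable P → Subset d
  ⟦ p ⟧ = tabulate (λ x → does (p x))

  ∈⟦⟧⁺ : ∀ {P : Fin d → Set} (p : U.Decidable P) {x} → P x → x ∈ₛ ⟦ p ⟧
  ∈⟦⟧⁺ p {x} px = lookup⇒[]= x _ (trans (lookup∘tabulate _ x) (dec-true (p x) px))

  ∈⟦⟧⁻ : ∀ {P : Fin d → Set} (p : U.Decidable P) {x} → x ∈ₛ ⟦ p ⟧ → P x
  ∈⟦⟧⁻ p {x} x∈ with p x | trans (sym (lookup∘tabulate (λ x → does (p x)) x)) ([]=⇒lookup x∈)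
  ... | yes px | _ = px

  below : (Fin d → ℕ) → ℕ → Subset d
  below g m = ⟦ (λ x → g x <? m) ⟧

  level : (Fin d → ℕ) → ℕ → Subset d
  level g m = ⟦ (λ x → g x ≟ m) ⟧

  below-0 : ∀ g → below g 0 ≡ ∅
  below-0 g = Empty-unique (λ (x , x∈) → case ∈⟦⟧⁻ (λ x → g x <? 0) x∈ of λ ())

  below-suc : ∀ g m → below g (suc m) ≡ below g m ∪ level g m
  below-suc g m = ⊆-antisym
    (λ x∈ → x∈p∪q⁺ (Data.Sum.map (∈⟦⟧⁺ (λ x → g x <? m)) (∈⟦⟧⁺ (λ x → g x ≟ m))
                                 (m<1+n⇒m<n∨m≡n (∈⟦⟧⁻ (λ x → g x <? suc m) x∈))))
    (λ x∈ → ∈⟦⟧⁺ (λ x → g x <? suc m) ([ (λ x∈b → m≤n⇒m≤1+n (∈⟦⟧⁻ (λ x → g x <? m) x∈b))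
                    , (λ x∈l → ≤-reflexive (cong suc (∈⟦⟧⁻ (λ x → g x ≟ m) x∈l))) ]′ (x∈p∪q⁻ _ _ x∈)))

  below-level-disjoint : ∀ g m → Empty (below g m ∩ level g m)
  below-level-disjoint g m (x , x∈) with x∈p∩q⁻ (below g m) (level g m) x∈
  ... | x∈b , x∈l = <-irrefl (∈⟦⟧⁻ (λ x → g x ≟ m) x∈l) (∈⟦⟧⁻ (λ x → g x <? m) x∈b)

  below-⊤ : ∀ g m → (∀ x → g x < m) → below g m ≡ ⊤
  below-⊤ g m g<m = ⊆-antisym (λ _ → ∈⊤) (λ {x} _ → ∈⟦⟧⁺ (λ x → g x <? m) (g<m x))

module _ {n d : ℕ} {Lm : List (Word n d)} {i j : Fin n} where

  Available : Subset d → Set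
  Available S = ∀ x → x ∈ₛ S → aW i x ∈ Lm × bW x j ∈ Lm

  sum-of-≤1-term-derivable : ∀ S → Available S → (∀ {x y} → x ∈ₛ S → y ∈ₛ S → x ≡ y) → Derivable Lm (sW i j S)
  sum-of-≤1-term-derivable S available unique with nonempty? S
  ... | yes (y , y∈S) = subst (λ T → Derivable Lm (sW i j T)) (sym S≡⁅y⁆)
                          (mul (held (proj₁ (available y y∈S))) (held (proj₂ (available y y∈S))))
    where
    S≡⁅y⁆ : S ≡ ⁅ y ⁆
    S≡⁅y⁆ = ⊆-antisym (λ x∈S → subst (_∈ₛ ⁅ y ⁆) (sym (unique x∈S y∈S)) (x∈⁅x⁆ y))
                      (λ x∈⁅y⁆ → subst (_∈ₛ S) (sym (x∈⁅y⁆⇒x≡y y x∈⁅y⁆)) y∈S)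
  ... | no empty = subst (λ T → Derivable Lm (sW i j T)) (sym (Empty-unique empty)) (zero-sum i j)

  sum-derivable-below : ∀ S m → Available S → Derivable Lm (sW i j (S ∩ below toℕ m))
  sum-derivable-below S zero available = sum-of-≤1-term-derivable _ (λ x x∈ → available x (proj₁ (x∈p∩q⁻ S _ x∈)))
    (λ x∈ _ → case ∈⟦⟧⁻ (λ x → toℕ x <? 0) (proj₂ (x∈p∩q⁻ S _ x∈)) of λ ())
  sum-derivable-below S (suc m) available = subst (λ T → Derivable Lm (sW i j T)) (sym split)
    (add (sum-derivable-below S m available) last disjoint)
    where
    split : S ∩ below toℕ (suc m) ≡ (S ∩ below toℕ m) ∪ (S ∩ level toℕ m)
    split = trans (cong (S ∩_) (below-suc toℕ m)) (∩-distribˡ-∪ S _ _)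
    last : Derivable Lm (sW i j (S ∩ level toℕ m))
    last = sum-of-≤1-term-derivable _ (λ x x∈ → available x (proj₁ (x∈p∩q⁻ S _ x∈)))
      (λ x∈ y∈ → Finₚ.toℕ-injective (trans (∈⟦⟧⁻ (λ x → toℕ x ≟ m) (proj₂ (x∈p∩q⁻ S _ x∈)))
                                            (sym (∈⟦⟧⁻ (λ x → toℕ x ≟ m) (proj₂ (x∈p∩q⁻ S _ y∈))))))
    disjoint : Empty ((S ∩ below toℕ m) ∩ (S ∩ level toℕ m))
    disjoint (x , x∈) with x∈p∩q⁻ (S ∩ below toℕ m) _ x∈
    ... | x∈b , x∈l = below-level-disjoint toℕ m (x , x∈p∩q⁺ (proj₂ (x∈p∩q⁻ S _ x∈b) , proj₂ (x∈p∩q⁻ S _ x∈l)))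

  sum-derivable : ∀ S → Available S → Derivable Lm (sW i j S)
  sum-derivable S available = subst (λ T → Derivable Lm (sW i j T)) S∩⊤≡S (sum-derivable-below S d available)
    where
    S∩⊤≡S : S ∩ below toℕ d ≡ S
    S∩⊤≡S = trans (cong (S ∩_) (below-⊤ toℕ d Finₚ.toℕ<n)) (∩-identityʳ S)

gather : ∀ {A : Set} {m} → (Fin m → List A) → List A
gather g = concat (List.tabulate g)

length-gather : ∀ {A : Set} {m} (g : Fin m → List A) → length (gather g) ≡ Σp (λ x → length (g x))
length-gather {m = zero} g = refl
length-gather {m = suc m} g = trans (length-++ (g fz)) (cong (length (g fz) +_) (length-gather {m = m} (g ∘ fs)))

∈-gather⁺ : ∀ {A : Set} {m} (g : Fin m → List A) x {w} → w ∈ g x → w ∈ gather g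
∈-gather⁺ g x w∈ = ∈-concat⁺′ w∈ (Anyₚ.tabulate⁺ x refl)

∈-gather⁻ : ∀ {A : Set} {m} (g : Fin m → List A) {w} → w ∈ gather g → ∃ λ x → w ∈ g x
∈-gather⁻ g w∈ = Anyₚ.tabulate⁻ (∈-concat⁻ (List.tabulate g) w∈)

when : ∀ {A : Set} → Dec P → A → List A
when (yes _) w = [ w ]
when (no _) w = []

length-when : ∀ {A : Set} (p : Dec P) (w : A) → length (when p w) ≡ 𝟙 p
length-when (yes _) w = refl
length-when (no _) w = refl

∈-when⁻ : ∀ {A : Set} (p : Dec P) {w v : A} → v ∈ when p w → P × v ≡ w
∈-when⁻ (yes p) (here v≡w) = p , v≡w

∈-when⁺ : ∀ {A : Set} (p : Dec P) (w : A) → P → w ∈ when p w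
∈-when⁺ (yes _) w _ = here refl
∈-when⁺ (no ¬p) w p = ⊥-elim (¬p p)

length-gather-when : ∀ {m} {A : Set} {Q : Fin m → Set ℓ₂} (p : Dec P) (q : ∀ x → Dec (Q x)) (w : Fin m → A) →
                     length (gather (λ x → when (p ×-dec q x) (w x))) ≡ 𝟙 p * Σp (λ x → 𝟙 (q x))
length-gather-when {m = m} p q w = begin
  length (gather (λ x → when (p ×-dec q x) (w x))) ≡⟨ length-gather (λ x → when (p ×-dec q x) (w x)) ⟩
  Σp (λ x → length (when (p ×-dec q x) (w x)))     ≡⟨ ∑-cong (finite m) (λ x → trans (length-when _ (w x)) (𝟙-× p (q x))) ⟩
  Σp (λ x → 𝟙 p * 𝟙 (q x))                         ≡⟨ Σp-* {m} (𝟙 p) _ ⟩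
  𝟙 p * Σp (λ x → 𝟙 (q x))                         ∎
  where open ≡-Reasoning

length-gather-[] : ∀ {m} {A : Set} (w : Fin m → A) → length (gather (λ x → [ w x ])) ≡ m
length-gather-[] {m} w = trans (length-gather (λ x → [ w x ])) (Σp-count m)

module _ (s : ℕ) ⦃ _ : NonZero s ⦄ where

  [r+q*s]%s≡r : ∀ r q → r < s → (r + q * s) % s ≡ r
  [r+q*s]%s≡r r q r<s = trans ([m+kn]%n≡m%n r q s) (m<n⇒m%n≡m r<s)

  [r+q*s]/s≡q : ∀ r q → r < s → (r + q * s) / s ≡ q
  [r+q*s]/s≡q r q r<s = sym (*-cancelʳ-≡ q ((r + q * s) / s) s (+-cancelˡ-≡ r _ _ (begin
      r + q * s                             ≡⟨ m≡m%n+[m/n]*n (r + q * s) s ⟩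
      (r + q * s) % s + (r + q * s) / s * s ≡⟨ cong (_+ (r + q * s) / s * s) ([r+q*s]%s≡r r q r<s) ⟩
      r + (r + q * s) / s * s               ∎)))
    where open ≡-Reasoning

  %-/-injective : ∀ a b → a % s ≡ b % s → a / s ≡ b / s → a ≡ b
  %-/-injective a b a%≡ a/≡ = begin
    a                 ≡⟨ m≡m%n+[m/n]*n a s ⟩
    a % s + a / s * s ≡⟨ cong₂ (λ r q → r + q * s) a%≡ a/≡ ⟩
    b % s + b / s * s ≡⟨ sym (m≡m%n+[m/n]*n b s) ⟩
    b                 ∎
    where open ≡-Reasoning

∈-gather²-when⁺ : ∀ {m l} {A : Set} {P : Fin m → Set ℓ₁} {Q : Fin l → Set ℓ₂} (p : ∀ i → Dec (P i)) (q : ∀ x → Dec (Q x))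
                  (w : Fin m → Fin l → A) {i x} → P i → Q x →
                  w i x ∈ gather (λ i → gather λ x → when (p i ×-dec q x) (w i x))
∈-gather²-when⁺ p q w {i} {x} pᵢ qₓ =
  ∈-gather⁺ _ i (∈-gather⁺ (λ x → when (p i ×-dec q x) (w i x)) x (∈-when⁺ (p i ×-dec q x) _ (pᵢ , qₓ)))

∈-gather²-when⁻ : ∀ {m l} {A : Set} {P : Fin m → Set ℓ₁} {Q : Fin l → Set ℓ₂} (p : ∀ i → Dec (P i)) (q : ∀ x → Dec (Q x))
                  (w : Fin m → Fin l → A) {v} → v ∈ gather (λ i → gather λ x → when (p i ×-dec q x) (w i x)) →
                  ∃ λ i → ∃ λ x → P i × Q x × v ≡ w i x
∈-gather²-when⁻ p q w v∈ with i , v∈ᵢ ← ∈-gather⁻ _ v∈ with x , v∈ᵢₓ ← ∈-gather⁻ _ v∈ᵢ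
  with (pᵢ , qₓ) , refl ← ∈-when⁻ (p i ×-dec q x) v∈ᵢₓ = i , x , pᵢ , qₓ , refl

module _ {n d : ℕ} where

  rowCol : Config n d
  rowCol q = gather (λ x → [ aW q x ]) ++ gather (λ x → [ bW x q ])

  length-rowCol : ∀ q → length (rowCol q) ≡ d + d
  length-rowCol q = trans (length-++ (gather {m = d} (λ x → [ aW q x ])) {ys = gather {m = d} (λ x → [ bW x q ])})
                          (cong₂ _+_ (length-gather-[] {d} (aW q)) (length-gather-[] {d} (λ x → bW x q)))

  aW∈rowCol : ∀ q x → aW q x ∈ rowCol q
  aW∈rowCol q x = ∈-++⁺ˡ (∈-gather⁺ (λ x → [ aW q x ]) x (here refl))

  bW∈rowCol : ∀ q x → bW x q ∈ rowCol q
  bW∈rowCol q x = ∈-++⁺ʳ (gather (λ x → [ aW q x ])) (∈-gather⁺ (λ x → [ bW x q ]) x (here refl))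

module Redistribution {n d : ℕ} (C₀ : Config n d) (even : EvenInput C₀) where

  holderA : Fin n → Fin d → Fin n
  holderA i x = proj₁ (proj₁ even i x)

  holderB : Fin d → Fin n → Fin n
  holderB x j = proj₁ (proj₁ (proj₂ even) x j)

  message : Fin n → Fin n → List (Word n d)
  message p q = gather (λ x → when (holderA q x Finₚ.≟ p) (aW q x)) ++ gather (λ x → when (holderB x q Finₚ.≟ p) (bW x q))

  length-message : ∀ p q → length (message p q) ≡ Σp (λ x → 𝟙 (holderA q x Finₚ.≟ p)) + Σp (λ x → 𝟙 (holderB x q Finₚ.≟ p))
  length-message p q =
    trans (length-++ (gather (λ x → when (holderA q x Finₚ.≟ p) (aW q x))) {ys = gather (λ x → when (holderB x q Finₚ.≟ p) (bW x q))})
      (cong₂ _+_ (trans (length-gather (λ x → when (holderA q x Finₚ.≟ p) (aW q x)))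
                        (∑-cong (finite d) (λ x → length-when (holderA q x Finₚ.≟ p) (aW q x))))
                 (trans (length-gather (λ x → when (holderB x q Finₚ.≟ p) (bW x q)))
                        (∑-cong (finite d) (λ x → length-when (holderB x q Finₚ.≟ p) (bW x q)))))

  sent≤4d : ∀ p → Σp (λ q → length (message p q)) ≤ 2 * d + 2 * d
  sent≤4d p = begin
      Σp (λ q → length (message p q))
    ≡⟨ trans (∑-cong (finite n) (length-message p)) (Σp-+ {n} _ _) ⟩
      ∑ Entries (λ (q , x) → 𝟙 (holderA q x Finₚ.≟ p)) + ∑ Entries (λ (q , x) → 𝟙 (holderB x q Finₚ.≟ p))
    ≤⟨ +-mono-≤ (∑-mono Entries (λ (q , x) → 𝟙-mono (holderA q x Finₚ.≟ p) _ (λ { refl → proj₂ (proj₁ even q x) })))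
                (∑-mono Entries (λ (q , x) → 𝟙-mono (holderB x q Finₚ.≟ p) _ (λ { refl → proj₂ (proj₁ (proj₂ even) x q) }))) ⟩
      ∑ Entries (λ (i , x) → holdsA (C₀ p) i x) + ∑ Entries (λ (j , x) → holdsB (C₀ p) x j)
    ≤⟨ +-mono-≤ (∑-holdsA≤length (C₀ p)) (∑-holdsB≤length (C₀ p)) ⟩
      length (C₀ p) + length (C₀ p)
    ≤⟨ +-mono-≤ (C₀≤2d p) (C₀≤2d p) ⟩
      2 * d + 2 * d ∎
    where
    open ≤-Reasoning
    C₀≤2d = proj₂ (proj₂ (proj₂ even))

  received≤2d : ∀ q → Σp (λ p → length (message p q)) ≤ d + d
  received≤2d q = begin
      Σp (λ p → length (message p q))
    ≡⟨ trans (∑-cong (finite n) (λ p → length-message p q)) (Σp-+ {n} _ _) ⟩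
      (Σp λ p → Σp λ x → 𝟙 (holderA q x Finₚ.≟ p)) + (Σp λ p → Σp λ x → 𝟙 (holderB x q Finₚ.≟ p))
    ≡⟨ cong₂ _+_ (Σp-swap {n} {d} _) (Σp-swap {n} {d} _) ⟩
      (Σp λ x → Σp λ p → 𝟙 (holderA q x Finₚ.≟ p)) + (Σp λ x → Σp λ p → 𝟙 (holderB x q Finₚ.≟ p))
    ≤⟨ +-mono-≤ (Σp-mono {d} (λ x → Σp-𝟙≤1 (λ p → holderA q x Finₚ.≟ p) (λ p p' e e' → trans (sym e) e')))
                (Σp-mono {d} (λ x → Σp-𝟙≤1 (λ p → holderB x q Finₚ.≟ p) (λ p p' e e' → trans (sym e) e'))) ⟩
      Σp {d} (λ _ → 1) + Σp {d} (λ _ → 1)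
    ≡⟨ cong₂ _+_ (Σp-count d) (Σp-count d) ⟩
      d + d ∎
    where open ≤-Reasoning

  message⊆C₀ : ∀ p q → message p q ⊆ C₀ p
  message⊆C₀ p q m with ∈-++⁻ (gather (λ x → when (holderA q x Finₚ.≟ p) (aW q x))) m
  ... | inj₁ m₁ with x , m₂ ← ∈-gather⁻ _ m₁ with refl , refl ← ∈-when⁻ (holderA q x Finₚ.≟ p) m₂ = proj₂ (proj₁ even q x)
  ... | inj₂ m₁ with x , m₂ ← ∈-gather⁻ _ m₁ with refl , refl ← ∈-when⁻ (holderB x q Finₚ.≟ p) m₂ = proj₂ (proj₁ (proj₂ even) x q)

  received : ∀ {q} p {w} → w ∈ message p q → w ∈ (C₀ q ++ concat (List.tabulate (λ p → message p q)))
  received {q} p m = ∈-++⁺ʳ (C₀ q) (∈-gather⁺ (λ p → message p q) p m)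

  rowCol⊆received : ∀ q → rowCol q ⊆ (C₀ q ++ concat (List.tabulate (λ p → message p q)))
  rowCol⊆received q m with ∈-++⁻ (gather (λ x → [ aW q x ])) m
  ... | inj₁ m₁ with x , here refl ← ∈-gather⁻ (λ x → [ aW q x ]) m₁ = received (holderA q x)
        (∈-++⁺ˡ (∈-gather⁺ (λ x' → when (holderA q x' Finₚ.≟ holderA q x) (aW q x')) x (∈-when⁺ (holderA q x Finₚ.≟ holderA q x) _ refl)))
  ... | inj₂ m₁ with x , here refl ← ∈-gather⁻ (λ x → [ bW x q ]) m₁ = received (holderB x q)
        (∈-++⁺ʳ (gather (λ x' → when (holderA q x' Finₚ.≟ holderB x q) (aW q x')))
          (∈-gather⁺ (λ x' → when (holderB x' q Finₚ.≟ holderB x q) (bW x' q)) x (∈-when⁺ (holderB x q Finₚ.≟ holderB x q) _ refl)))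

  redistribute : ∀ M → 2 * d + 2 * d ≤ M → Step M C₀ rowCol
  redistribute M 4d≤M =
    C₀ , message , (λ p → ≤-trans (proj₂ (proj₂ (proj₂ even)) p) 2d≤M) , (λ p m → held m) , message⊆C₀ ,
    (λ p → ≤-trans (sent≤4d p) 4d≤M) , (λ q → ≤-trans (received≤2d q) d+d≤M) ,
    rowCol⊆received , (λ q → ≤-trans (≤-reflexive (length-rowCol {n} {d} q)) d+d≤M)
    where
    2d≤M : 2 * d ≤ M
    2d≤M = ≤-trans (m≤m+n (2 * d) (2 * d)) 4d≤M
    d+d≤M : d + d ≤ M
    d+d≤M = ≤-trans (≤-reflexive (cong (d +_) (sym (+-identityʳ d)))) 2d≤M

-- Processors q < s² form an s × s grid: q owns the entries c_{ij} with ⌊i/c⌋ = ⌊q/s⌋ and ⌊j/c⌋ = q mod s,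
-- where c = s + 2, so that s groups of c indices cover all n ≤ s c of them. In round k every processor
-- receives the k-th chunk {x | ⌊x/s⌋ = k} of its rows of A and columns of B and adds it to its partial sums.
module Grid (n d s : ℕ) ⦃ _ : NonZero s ⦄ (s*s≤n : s * s ≤ n) (n≤s*c : n ≤ s * suc (suc s)) where

  c : ℕ
  c = suc (suc s)

  ownsRow? : (q i : Fin n) → Dec (toℕ q < s * s × toℕ i / c ≡ toℕ q / s)
  ownsRow? q i = (toℕ q <? s * s) ×-dec (toℕ i / c ≟ toℕ q / s)

  ownsCol? : (q j : Fin n) → Dec (toℕ q < s * s × toℕ j / c ≡ toℕ q % s)
  ownsCol? q j = (toℕ q <? s * s) ×-dec (toℕ j / c ≟ toℕ q % s)

  inChunk? : (k : ℕ) (x : Fin d) → Dec (toℕ x / s ≡ k)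
  inChunk? k x = toℕ x / s ≟ k

  summed : ℕ → Subset d
  summed = below (λ x → toℕ x / s)

  chunk : ℕ → Subset d
  chunk = level (λ x → toℕ x / s)

  partialSums rowChunks colChunks : ℕ → Config n d
  partialSums k q = gather λ i → gather λ j → when (ownsRow? q i ×-dec ownsCol? q j) (sW i j (summed k))
  rowChunks k q = gather λ i → gather λ x → when (ownsRow? q i ×-dec inChunk? k x) (aW i x)
  colChunks k q = gather λ j → gather λ x → when (ownsCol? q j ×-dec inChunk? k x) (bW x j)

  memory : ℕ → Config n d
  memory k q = rowCol q ++ (partialSums k q ++ (rowChunks k q ++ colChunks k q))

  chunkMessage : ℕ → Fin n → Fin n → List (Word n d)
  chunkMessage k p q = gather (λ x → when (ownsRow? q p ×-dec inChunk? k x) (aW p x))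
                    ++ gather (λ x → when (ownsCol? q p ×-dec inChunk? k x) (bW x p))

  chunk-size : ∀ k → Σp (λ x → 𝟙 (inChunk? k x)) ≤ s
  chunk-size k = Σp-𝟙≤-injection (inChunk? k) s (λ x → toℕ x % s) (λ x _ → m%n<n (toℕ x) s)
    (λ x x' x/≡k x'/≡k x%≡ → Finₚ.toℕ-injective (%-/-injective s _ _ x%≡ (trans x/≡k (sym x'/≡k))))

  row-owners : ∀ i → Σp (λ q → 𝟙 (ownsRow? q i)) ≤ s
  row-owners i = Σp-𝟙≤-injection (λ q → ownsRow? q i) s (λ q → toℕ q % s) (λ q _ → m%n<n (toℕ q) s)
    (λ q q' (_ , i/≡q/) (_ , i/≡q'/) q%≡ →
      Finₚ.toℕ-injective (%-/-injective s _ _ q%≡ (trans (sym i/≡q/) i/≡q'/)))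

  col-owners : ∀ j → Σp (λ q → 𝟙 (ownsCol? q j)) ≤ s
  col-owners j = Σp-𝟙≤-injection (λ q → ownsCol? q j) s (λ q → toℕ q / s) (λ q (q<ss , _) → m<n*o⇒m/o<n q<ss)
    (λ q q' (_ , j/≡q%) (_ , j/≡q'%) q/≡ →
      Finₚ.toℕ-injective (%-/-injective s _ _ (trans (sym j/≡q%) j/≡q'%) q/≡))

  owned-rows : ∀ q → Σp (λ i → 𝟙 (ownsRow? q i)) ≤ c
  owned-rows q = Σp-𝟙≤-injection (ownsRow? q) c (λ i → toℕ i % c) (λ i _ → m%n<n (toℕ i) c)
    (λ i i' (_ , i/≡) (_ , i'/≡) i%≡ → Finₚ.toℕ-injective (%-/-injective c _ _ i%≡ (trans i/≡ (sym i'/≡))))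

  owned-cols : ∀ q → Σp (λ j → 𝟙 (ownsCol? q j)) ≤ c
  owned-cols q = Σp-𝟙≤-injection (ownsCol? q) c (λ j → toℕ j % c) (λ j _ → m%n<n (toℕ j) c)
    (λ j j' (_ , j/≡) (_ , j'/≡) j%≡ → Finₚ.toℕ-injective (%-/-injective c _ _ j%≡ (trans j/≡ (sym j'/≡))))

  length-chunkMessage : ∀ k p q → length (chunkMessage k p q) ≤ 𝟙 (ownsRow? q p) * s + 𝟙 (ownsCol? q p) * s
  length-chunkMessage k p q = begin
      length (chunkMessage k p q)
    ≡⟨ length-++ (gather (λ x → when (ownsRow? q p ×-dec inChunk? k x) (aW p x)))
                 {ys = gather (λ x → when (ownsCol? q p ×-dec inChunk? k x) (bW x p))} ⟩
      length (gather (λ x → when (ownsRow? q p ×-dec inChunk? k x) (aW p x)))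
        + length (gather (λ x → when (ownsCol? q p ×-dec inChunk? k x) (bW x p)))
    ≡⟨ cong₂ _+_ (length-gather-when (ownsRow? q p) (inChunk? k) (aW p))
                 (length-gather-when (ownsCol? q p) (inChunk? k) (λ x → bW x p)) ⟩
      𝟙 (ownsRow? q p) * Σp (λ x → 𝟙 (inChunk? k x)) + 𝟙 (ownsCol? q p) * Σp (λ x → 𝟙 (inChunk? k x))
    ≤⟨ +-mono-≤ (*-monoʳ-≤ (𝟙 (ownsRow? q p)) (chunk-size k)) (*-monoʳ-≤ (𝟙 (ownsCol? q p)) (chunk-size k)) ⟩
      𝟙 (ownsRow? q p) * s + 𝟙 (ownsCol? q p) * s ∎
    where open ≤-Reasoning

  sent≤ : ∀ k p → Σp (λ q → length (chunkMessage k p q)) ≤ s * s + s * s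
  sent≤ k p = begin
      Σp (λ q → length (chunkMessage k p q))
    ≤⟨ Σp-mono {n} (length-chunkMessage k p) ⟩
      Σp (λ q → 𝟙 (ownsRow? q p) * s + 𝟙 (ownsCol? q p) * s)
    ≡⟨ trans (Σp-+ {n} _ _) (cong₂ _+_ (∑-*ʳ (finite n) s _) (∑-*ʳ (finite n) s _)) ⟩
      Σp (λ q → 𝟙 (ownsRow? q p)) * s + Σp (λ q → 𝟙 (ownsCol? q p)) * s
    ≤⟨ +-mono-≤ (*-monoˡ-≤ s (row-owners p)) (*-monoˡ-≤ s (col-owners p)) ⟩
      s * s + s * s ∎
    where open ≤-Reasoning

  received≤ : ∀ k q → Σp (λ p → length (chunkMessage k p q)) ≤ c * s + c * s
  received≤ k q = begin
      Σp (λ p → length (chunkMessage k p q))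
    ≤⟨ Σp-mono {n} (λ p → length-chunkMessage k p q) ⟩
      Σp (λ p → 𝟙 (ownsRow? q p) * s + 𝟙 (ownsCol? q p) * s)
    ≡⟨ trans (Σp-+ {n} _ _) (cong₂ _+_ (∑-*ʳ (finite n) s _) (∑-*ʳ (finite n) s _)) ⟩
      Σp (λ p → 𝟙 (ownsRow? q p)) * s + Σp (λ p → 𝟙 (ownsCol? q p)) * s
    ≤⟨ +-mono-≤ (*-monoˡ-≤ s (owned-rows q)) (*-monoˡ-≤ s (owned-cols q)) ⟩
      c * s + c * s ∎
    where open ≤-Reasoning

  length-gather²-when : ∀ {m} {P : Fin n → Set} {Q : Fin m → Set} (p : ∀ i → Dec (P i)) (q : ∀ x → Dec (Q x))
                        (w : Fin n → Fin m → Word n d) →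
                        length (gather λ i → gather λ x → when (p i ×-dec q x) (w i x))
                          ≡ Σp (λ i → 𝟙 (p i)) * Σp (λ x → 𝟙 (q x))
  length-gather²-when p q w =
    trans (length-gather (λ i → gather λ x → when (p i ×-dec q x) (w i x)))
          (trans (∑-cong (finite n) (λ i → length-gather-when (p i) q (w i))) (∑-*ʳ (finite n) _ _))

  length-rowChunks : ∀ k q → length (rowChunks k q) ≤ c * s
  length-rowChunks k q = ≤-trans (≤-reflexive (length-gather²-when (ownsRow? q) (inChunk? k) aW))
                                 (*-mono-≤ (owned-rows q) (chunk-size k))

  length-colChunks : ∀ k q → length (colChunks k q) ≤ c * s
  length-colChunks k q = ≤-trans (≤-reflexive (length-gather²-when (ownsCol? q) (inChunk? k) (λ j x → bW x j)))
                                 (*-mono-≤ (owned-cols q) (chunk-size k))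

  length-partialSums : ∀ k q → length (partialSums k q) ≤ c * c
  length-partialSums k q = ≤-trans (≤-reflexive (length-gather²-when (ownsRow? q) (ownsCol? q) (λ i j → sW i j (summed k))))
                                   (*-mono-≤ (owned-rows q) (owned-cols q))

  chunkMessage⊆rowCol : ∀ k p q → chunkMessage k p q ⊆ rowCol p
  chunkMessage⊆rowCol k p q m with ∈-++⁻ (gather (λ x → when (ownsRow? q p ×-dec inChunk? k x) (aW p x))) m
  ... | inj₁ m₁ with x , m₂ ← ∈-gather⁻ _ m₁ with _ , refl ← ∈-when⁻ (ownsRow? q p ×-dec inChunk? k x) m₂ = aW∈rowCol p x
  ... | inj₂ m₁ with x , m₂ ← ∈-gather⁻ _ m₁ with _ , refl ← ∈-when⁻ (ownsCol? q p ×-dec inChunk? k x) m₂ = bW∈rowCol p x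

  chunks-received : ∀ k q → (rowChunks k q ++ colChunks k q) ⊆ gather (λ p → chunkMessage k p q)
  chunks-received k q m with ∈-++⁻ (rowChunks k q) m
  ... | inj₁ m₁ with i , x , owns , x∈k , refl ← ∈-gather²-when⁻ (ownsRow? q) (inChunk? k) aW m₁ =
    ∈-gather⁺ (λ p → chunkMessage k p q) i
      (∈-++⁺ˡ (∈-gather⁺ _ x (∈-when⁺ (ownsRow? q i ×-dec inChunk? k x) _ (owns , x∈k))))
  ... | inj₂ m₁ with j , x , owns , x∈k , refl ← ∈-gather²-when⁻ (ownsCol? q) (inChunk? k) (λ j x → bW x j) m₁ =
    ∈-gather⁺ (λ p → chunkMessage k p q) j
      (∈-++⁺ʳ (gather (λ x → when (ownsRow? q j ×-dec inChunk? k x) (aW j x)))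
              (∈-gather⁺ _ x (∈-when⁺ (ownsCol? q j ×-dec inChunk? k x) _ (owns , x∈k))))

  module Rounds (M : ℕ) (compute≤M : d + d + c * c ≤ M) (send≤M : s * s + s * s ≤ M)
                (receive≤M : c * s + c * s ≤ M) (store≤M : d + d + (c * c + (c * s + c * s)) ≤ M) where

    chunkRound : ∀ k (C E : Config n d) → (∀ q → rowCol q ⊆ C q) → (∀ q {w} → w ∈ E q → Derivable (C q) w) →
                 (∀ q → length (E q) ≤ c * c) → Step M C (λ q → rowCol q ++ (E q ++ (rowChunks k q ++ colChunks k q)))
    chunkRound k C E rowCol⊆C derivable E≤cc =
        L , chunkMessage k , L≤M , computed , sent⊆L
      , (λ p → ≤-trans (sent≤ k p) send≤M) , (λ q → ≤-trans (received≤ k q) receive≤M) , stored , stored≤M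
      where
      L : Config n d
      L q = rowCol q ++ E q
      L≤M : ∀ q → length (L q) ≤ M
      L≤M q = ≤-trans (≤-reflexive (trans (length-++ (rowCol q) {ys = E q}) (cong (_+ length (E q)) (length-rowCol {n} {d} q))))
                      (≤-trans (+-monoʳ-≤ (d + d) (E≤cc q)) compute≤M)
      computed : ∀ q {w} → w ∈ L q → Derivable (C q) w
      computed q m with ∈-++⁻ (rowCol q) m
      ... | inj₁ m₁ = held (rowCol⊆C q m₁)
      ... | inj₂ m₂ = derivable q m₂
      sent⊆L : ∀ p q → chunkMessage k p q ⊆ L p
      sent⊆L p q m = ∈-++⁺ˡ (chunkMessage⊆rowCol k p q m)
      stored : ∀ q → (rowCol q ++ (E q ++ (rowChunks k q ++ colChunks k q))) ⊆ (L q ++ gather (λ p → chunkMessage k p q))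
      stored q m with ∈-++⁻ (rowCol q) m
      ... | inj₁ m₁ = ∈-++⁺ˡ (∈-++⁺ˡ m₁)
      ... | inj₂ m₂ with ∈-++⁻ (E q) m₂
      ...   | inj₁ m₃ = ∈-++⁺ˡ (∈-++⁺ʳ (rowCol q) m₃)
      ...   | inj₂ m₃ = ∈-++⁺ʳ (L q) (chunks-received k q m₃)
      stored≤M : ∀ q → length (rowCol q ++ (E q ++ (rowChunks k q ++ colChunks k q))) ≤ M
      stored≤M q = begin
          length (rowCol q ++ (E q ++ (rowChunks k q ++ colChunks k q)))
        ≡⟨ trans (length-++ (rowCol q) {ys = E q ++ (rowChunks k q ++ colChunks k q)})
                 (cong₂ _+_ (length-rowCol {n} {d} q)
                        (trans (length-++ (E q) {ys = rowChunks k q ++ colChunks k q})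
                               (cong (length (E q) +_) (length-++ (rowChunks k q) {ys = colChunks k q})))) ⟩
          d + d + (length (E q) + (length (rowChunks k q) + length (colChunks k q)))
        ≤⟨ +-monoʳ-≤ (d + d) (+-mono-≤ (E≤cc q) (+-mono-≤ (length-rowChunks k q) (length-colChunks k q))) ⟩
          d + d + (c * c + (c * s + c * s))
        ≤⟨ store≤M ⟩
          M ∎
        where open ≤-Reasoning

    firstRound : Step M rowCol (memory 0)
    firstRound = chunkRound 0 rowCol (partialSums 0) (λ q m → m) empty-sums (length-partialSums 0)
      where
      empty-sums : ∀ q {w} → w ∈ partialSums 0 q → Derivable (rowCol q) w
      empty-sums q m with i , j , _ , _ , refl ← ∈-gather²-when⁻ (ownsRow? q) (ownsCol? q) (λ i j → sW i j (summed 0)) m =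
        subst (λ T → Derivable (rowCol q) (sW i j T)) (sym (below-0 (λ x → toℕ x / s))) (zero-sum i j)

    nextRound : ∀ k → Step M (memory k) (memory (suc k))
    nextRound k = chunkRound (suc k) (memory k) (partialSums (suc k)) (λ q m → ∈-++⁺ˡ m) extend (length-partialSums (suc k))
      where
      extend : ∀ q {w} → w ∈ partialSums (suc k) q → Derivable (memory k q) w
      extend q m
        with i , j , ownsᵢ , ownsⱼ , refl ← ∈-gather²-when⁻ (ownsRow? q) (ownsCol? q) (λ i j → sW i j (summed (suc k))) m =
        subst (λ T → Derivable (memory k q) (sW i j T)) (sym (below-suc _ k))
          (add (held old) (sum-derivable (chunk k) available) (below-level-disjoint _ k))
        where
        old : sW i j (summed k) ∈ memory k q
        old = ∈-++⁺ʳ (rowCol q) (∈-++⁺ˡ (∈-gather²-when⁺ (ownsRow? q) (ownsCol? q) (λ i j → sW i j (summed k)) ownsᵢ ownsⱼ))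
        available : ∀ x → x ∈ₛ chunk k → aW i x ∈ memory k q × bW x j ∈ memory k q
        available x x∈ =
            ∈-++⁺ʳ (rowCol q) (∈-++⁺ʳ (partialSums k q) (∈-++⁺ˡ
              (∈-gather²-when⁺ (ownsRow? q) (inChunk? k) aW ownsᵢ (∈⟦⟧⁻ (inChunk? k) x∈))))
          , ∈-++⁺ʳ (rowCol q) (∈-++⁺ʳ (partialSums k q) (∈-++⁺ʳ (rowChunks k q)
              (∈-gather²-when⁺ (ownsCol? q) (inChunk? k) (λ j x → bW x j) ownsⱼ (∈⟦⟧⁻ (inChunk? k) x∈))))

    rounds : ∀ m k → Run M m (memory k) (memory (m + k))
    rounds zero k = done
    rounds (suc m) k = step (nextRound k) (subst (Run M m (memory (suc k))) (cong memory (+-suc m k)) (rounds m (suc k)))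

  group< : ∀ (i : Fin n) → toℕ i / c < s
  group< i = m<n*o⇒m/o<n (≤-trans (Finₚ.toℕ<n i) n≤s*c)

  memory-output : ∀ T → d ≤ T * s → Output (memory T)
  memory-output T d≤Ts i j = q , ∈-++⁺ʳ (rowCol q) (∈-++⁺ˡ (subst (λ U → sW i j U ∈ partialSums T q) all-summed
    (∈-gather²-when⁺ (ownsRow? q) (ownsCol? q) (λ i j → sW i j (summed T)) (q<ss , row-group) (q<ss , col-group))))
    where
    q′ = toℕ j / c + toℕ i / c * s
    q′<ss : q′ < s * s
    q′<ss = ≤-trans (+-monoˡ-≤ (toℕ i / c * s) (group< j)) (*-monoˡ-≤ s (group< i))
    q : Fin n
    q = fromℕ< (≤-trans q′<ss s*s≤n)
    toℕ-q : toℕ q ≡ q′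
    toℕ-q = Finₚ.toℕ-fromℕ< _
    q<ss : toℕ q < s * s
    q<ss = subst (_< s * s) (sym toℕ-q) q′<ss
    row-group : toℕ i / c ≡ toℕ q / s
    row-group = sym (trans (cong (_/ s) toℕ-q) ([r+q*s]/s≡q s (toℕ j / c) (toℕ i / c) (group< j)))
    col-group : toℕ j / c ≡ toℕ q % s
    col-group = sym (trans (cong (_% s) toℕ-q) ([r+q*s]%s≡r s (toℕ j / c) (toℕ i / c) (group< j)))
    all-summed : summed T ≡ ⊤
    all-summed = below-⊤ _ T (λ x → m<n*o⇒m/o<n (≤-trans (Finₚ.toℕ<n x) d≤Ts))

integer-sqrt : ∀ n → ∃ λ s → 1 ≤ s × s * s ≤ suc n × suc n ≤ s * suc (suc s)
integer-sqrt zero = 1 , s≤s z≤n , s≤s z≤n , s≤s z≤n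
integer-sqrt (suc n) with integer-sqrt n
... | s , 1≤s , s²≤ , ≤s[s+2] with suc (suc n) ≤? s * suc (suc s)
...   | yes fits = s , 1≤s , m≤n⇒m≤1+n s²≤ , fits
...   | no ¬fits = suc s , s≤s z≤n , ≤-reflexive (sym next-square) ,
                   ≤-trans (≤-reflexive next-square) (*-monoʳ-≤ (suc s) (m≤n⇒m≤1+n (n≤1+n _)))
  where
  on-boundary : s * suc (suc s) ≡ suc n
  on-boundary = ≤-antisym (≤-pred (≰⇒> ¬fits)) ≤s[s+2]
  expand : ∀ s → suc s * suc s ≡ suc (s * suc (suc s))
  expand = solve-∀
  next-square : suc (suc n) ≡ suc s * suc s
  next-square = sym (trans (expand s) (cong suc on-boundary))

ceiling-multiple : ∀ s → 1 ≤ s → ∀ d → ∃ λ T → d ≤ T * s × T * s ≤ d + s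
ceiling-multiple s 1≤s zero = 0 , z≤n , z≤n
ceiling-multiple s 1≤s (suc d) with ceiling-multiple s 1≤s d
... | T , d≤Ts , Ts≤d+s with suc d ≤? T * s
...   | yes covers = T , covers , ≤-trans Ts≤d+s (n≤1+n _)
...   | no ¬covers = suc T
                   , ≤-trans (≤-reflexive (+-comm 1 d))
                       (≤-trans (+-mono-≤ (≤-reflexive (sym exact)) 1≤s) (≤-reflexive (+-comm (T * s) s)))
                   , ≤-trans (≤-reflexive (trans (cong (s +_) exact) (+-comm s d))) (n≤1+n _)
  where
  exact : T * s ≡ d
  exact = ≤-antisym (≤-pred (≰⇒> ¬covers)) d≤Ts

[a+b]²≤2a²+2b² : ∀ a b → (a + b) * (a + b) ≤ 2 * (a * a) + 2 * (b * b)
[a+b]²≤2a²+2b² a b = begin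
    (a + b) * (a + b)                 ≡⟨ e₁ a b ⟩
    (a * a + b * b) + 2 * (a * b)     ≤⟨ +-monoʳ-≤ (a * a + b * b) (2ab≤a²+b² a b) ⟩
    (a * a + b * b) + (a * a + b * b) ≡⟨ e₂ a b ⟩
    2 * (a * a) + 2 * (b * b)         ∎
  where
  open ≤-Reasoning
  e₁ : ∀ a b → (a + b) * (a + b) ≡ (a * a + b * b) + 2 * (a * b)
  e₁ = solve-∀
  e₂ : ∀ a b → (a * a + b * b) + (a * a + b * b) ≡ 2 * (a * a) + 2 * (b * b)
  e₂ = solve-∀

module Budget (n d s T : ℕ) (s*s≤n : s * s ≤ n) (n≤s[s+2] : n ≤ s * suc (suc s)) (1≤s : 1 ≤ s) (d≤n : d ≤ n)
              (Ts≤d+s : T * s ≤ d + s) where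

  c : ℕ
  c = suc (suc s)

  c≤3s : c ≤ 3 * s
  c≤3s = ≤-trans (+-monoˡ-≤ s (*-monoʳ-≤ 2 1≤s)) (≤-reflexive (e s))
    where e : ∀ s → 2 * s + s ≡ 3 * s
          e = solve-∀

  c*c≤9n : c * c ≤ 9 * n
  c*c≤9n = ≤-trans (*-mono-≤ c≤3s c≤3s) (≤-trans (≤-reflexive (e s)) (*-monoʳ-≤ 9 s*s≤n))
    where e : ∀ s → 3 * s * (3 * s) ≡ 9 * (s * s)
          e = solve-∀

  c*s≤3n : c * s ≤ 3 * n
  c*s≤3n = ≤-trans (*-monoˡ-≤ s c≤3s) (≤-trans (≤-reflexive (*-assoc 3 s s)) (*-monoʳ-≤ 3 s*s≤n))

  k*n≤20n : ∀ k → k ≤ 20 → k * n ≤ 20 * n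
  k*n≤20n k k≤20 = *-monoˡ-≤ n k≤20

  compute≤20n : d + d + c * c ≤ 20 * n
  compute≤20n = ≤-trans (+-mono-≤ (+-mono-≤ d≤n d≤n) c*c≤9n) (≤-trans (≤-reflexive (e n)) (k*n≤20n 11 (≤ᵇ⇒≤ 11 20 _)))
    where e : ∀ n → n + n + 9 * n ≡ 11 * n
          e = solve-∀

  send≤20n : s * s + s * s ≤ 20 * n
  send≤20n = ≤-trans (+-mono-≤ s*s≤n s*s≤n) (≤-trans (≤-reflexive (e n)) (k*n≤20n 2 (≤ᵇ⇒≤ 2 20 _)))
    where e : ∀ n → n + n ≡ 2 * n
          e = solve-∀

  receive≤20n : c * s + c * s ≤ 20 * n
  receive≤20n = ≤-trans (+-mono-≤ c*s≤3n c*s≤3n) (≤-trans (≤-reflexive (e n)) (k*n≤20n 6 (≤ᵇ⇒≤ 6 20 _)))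
    where e : ∀ n → 3 * n + 3 * n ≡ 6 * n
          e = solve-∀

  store≤20n : d + d + (c * c + (c * s + c * s)) ≤ 20 * n
  store≤20n = ≤-trans (+-mono-≤ (+-mono-≤ d≤n d≤n) (+-mono-≤ c*c≤9n (+-mono-≤ c*s≤3n c*s≤3n)))
                      (≤-trans (≤-reflexive (e n)) (k*n≤20n 17 (≤ᵇ⇒≤ 17 20 _)))
    where e : ∀ n → n + n + (9 * n + (3 * n + 3 * n)) ≡ 17 * n
          e = solve-∀

  redistribute≤20n : 2 * d + 2 * d ≤ 20 * n
  redistribute≤20n = ≤-trans (+-mono-≤ (*-monoʳ-≤ 2 d≤n) (*-monoʳ-≤ 2 d≤n))
                             (≤-trans (≤-reflexive (e n)) (k*n≤20n 4 (≤ᵇ⇒≤ 4 20 _)))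
    where e : ∀ n → 2 * n + 2 * n ≡ 4 * n
          e = solve-∀

  n≤3s² : n ≤ 3 * (s * s)
  n≤3s² = ≤-trans n≤s[s+2] (≤-trans (≤-reflexive (e s)) (+-monoʳ-≤ (s * s) (*-monoʳ-≤ 2 (m≤m*n s s ⦃ >-nonZero 1≤s ⦄))))
    where e : ∀ s → s * (2 + s) ≡ s * s + 2 * s
          e = solve-∀

  -- One redistribution round, the first chunk round and T further chunk rounds.
  R : ℕ
  R = suc (suc T)

  R*s≤d+3s : R * s ≤ d + 3 * s
  R*s≤d+3s = ≤-trans (≤-reflexive (e T s)) (≤-trans (+-monoˡ-≤ (2 * s) Ts≤d+s) (≤-reflexive (e′ d s)))
    where e : ∀ T s → (2 + T) * s ≡ T * s + 2 * s
          e = solve-∀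
          e′ : ∀ d s → d + s + 2 * s ≡ d + 3 * s
          e′ = solve-∀

  R²n≤72[n+d²] : R * R * n ≤ 72 * (n + d * d)
  R²n≤72[n+d²] = begin
      R * R * n                                  ≤⟨ *-monoʳ-≤ (R * R) n≤3s² ⟩
      R * R * (3 * (s * s))                      ≡⟨ e₁ R s ⟩
      3 * ((R * s) * (R * s))                    ≤⟨ *-monoʳ-≤ 3 (*-mono-≤ R*s≤d+3s R*s≤d+3s) ⟩
      3 * ((d + 3 * s) * (d + 3 * s))            ≤⟨ *-monoʳ-≤ 3 ([a+b]²≤2a²+2b² d (3 * s)) ⟩
      3 * (2 * (d * d) + 2 * (3 * s * (3 * s)))  ≡⟨ e₂ d s ⟩
      6 * (d * d) + 54 * (s * s)                 ≤⟨ +-mono-≤ (*-monoˡ-≤ (d * d) (≤ᵇ⇒≤ 6 72 _)) (*-mono-≤ (≤ᵇ⇒≤ 54 72 _) s*s≤n) ⟩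
      72 * (d * d) + 72 * n                      ≡⟨ e₃ d n ⟩
      72 * (n + d * d)                           ∎
    where
    open ≤-Reasoning
    e₁ : ∀ R s → R * R * (3 * (s * s)) ≡ 3 * ((R * s) * (R * s))
    e₁ = solve-∀
    e₂ : ∀ d s → 3 * (2 * (d * d) + 2 * (3 * s * (3 * s))) ≡ 6 * (d * d) + 54 * (s * s)
    e₂ = solve-∀
    e₃ : ∀ d n → 72 * (d * d) + 72 * n ≡ 72 * (n + d * d)
    e₃ = solve-∀

rounds-upper-bound : ∀ n d → d ≤ n → (C₀ : Config n d) → EvenInput C₀ →
                     ∃ λ R → ∃ λ C → Run (20 * n) R C₀ C × Output C × R * R * n ≤ 72 * (n + d * d)
rounds-upper-bound zero d d≤n C₀ even = 0 , C₀ , done , (λ ()) , z≤n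
rounds-upper-bound n@(suc n′) d d≤n C₀ even
  with s@(suc _) , 1≤s , s*s≤n , n≤s[s+2] ← integer-sqrt n′
  with T , d≤Ts , Ts≤d+s ← ceiling-multiple s 1≤s d =
    R , memory (T + 0) , step (Redistribution.redistribute C₀ even (20 * n) redistribute≤20n) (step firstRound (rounds T 0)) ,
    memory-output (T + 0) (subst (λ t → d ≤ t * s) (sym (+-identityʳ T)) d≤Ts) , R²n≤72[n+d²]
  where
  open Budget n d s T s*s≤n n≤s[s+2] 1≤s d≤n Ts≤d+s
  open Grid n d s s*s≤n n≤s[s+2]
  open Rounds (20 * n) compute≤20n send≤20n receive≤20n store≤20n

theorem6 :
  (∃ λ K → ∃ λ c → ∀ n d → d ≤ n → (C₀ : Config n d) → EvenInput C₀ →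
    ∃ λ R → ∃ λ C → Run (K * n) R C₀ C × Output C × R * R * n ≤ c * (n + d * d))
  ×
  (∀ K → ∃ λ k → ∀ n d → d ≤ n → (C₀ : Config n d) → EvenInput C₀ →
    ∀ R C → Run (K * n) R C₀ C → Output C → d * d ≤ suc k * (R * R * n))
theorem6 = (20 , 72 , rounds-upper-bound)
         , λ K → K * (K + 2) * (K + 2) , λ n d d≤n C₀ even R C r out →
             ≤-trans (rounds-lower-bound K n d d≤n C₀ even R C r out) (m≤n+m _ (R * R * n))
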